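{- Let $r,n,p,q,k$ be non-negative integers with $p\geq n$. Then \[ \sum_{j=0}^{p}(-1)^{j}\binom{j+q}{q}\binom{n+k+q+j}{k}\binom{n+k+p+q+1}{p-j}\genfrac{[}{]}{0pt}{}{n+r+j+q}{r+j+q}_{r} =\binom{n+k+q}{q}\sum_{j=0}^{n}(-1)^{j}\binom{n+k}{j+k}\genfrac{\{}{\}}{0pt}{}{j+k}{k}(r-1)^{n-j} \] and \[ \sum_{j=0}^{p}(-1)^{j}\binom{j+q}{q}\binom{n+k+q+j}{k}\binom{n+k+p+q+1}{p-j}\genfrac{\{}{\}}{0pt}{}{n+r+j+q}{r+j+q}_{r} =\binom{n+k+q}{q}\sum_{j=0}^{n}(-1)^{j}\binom{n+k}{j+k}\genfrac{[}{]}{0pt}{}{j+k}{k}(r-1)^{\underline{n-j}}. \]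
   Context: For non-negative integers $r,k$, the $r$-Stirling numbers of the first and second kind are defined by $\sum_{n\ge k}\genfrac{[}{]}{0pt}{}{n+r}{k+r}_r\frac{t^n}{n!}=\frac{1}{k!}\frac{(-\ln(1-t))^k}{(1-t)^r}$ and $\sum_{n\ge k}\genfrac{\{}{\}}{0pt}{}{n+r}{k+r}_r\frac{t^n}{n!}=\frac{1}{k!}(e^t-1)^k e^{rt}$. The unsubscripted $\genfrac{[}{]}{0pt}{}{m}{k}$ and $\genfrac{\{}{\}}{0pt}{}{m}{k}$ denote the ordinary (unsigned) Stirling numbers of the first and second kind (the case $r=0$). $x^{\underline{m}}=x(x-1)\cdots(x-m+1)$ for $m\ge1$, $x^{\underline{0}}=1$; and $0^0=1$. -}

module Defs where

open import Data.Nat using (ℕ; zero; suc) renaming (_+_ to _+ℕ_; _*_ to _*ℕ_)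
open import Data.Integer using (ℤ; +_; _+_; _*_; _-_; -_; 1ℤ; 0ℤ)

-- r-Stirling numbers of the first kind:  rStirling1 r n k = [ n+r , k+r ]_r.
-- Derived from the EGF  (1/k!) (-ln(1-t))^k / (1-t)^r  :  (1-t) f_k' = f_{k-1} + r f_k, so
--   a(0,k) = δ_{k,0},  a(n+1,0) = (n+r) a(n,0),  a(n+1,k+1) = (n+r) a(n,k+1) + a(n,k).
rStirling1 : ℕ → ℕ → ℕ → ℕ
rStirling1 r zero    zero    = 1
rStirling1 r zero    (suc k) = 0
rStirling1 r (suc n) zero    = (n +ℕ r) *ℕ rStirling1 r n zero
rStirling1 r (suc n) (suc k) = (n +ℕ r) *ℕ rStirling1 r n (suc k) +ℕ rStirling1 r n k

-- r-Stirling numbers of the second kind:  rStirling2 r n k = { n+r , k+r }_r.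
-- Derived from the EGF  (1/k!) (e^t-1)^k e^{rt}  :  g_k' = (k+r) g_k + g_{k-1}, so
--   b(0,k) = δ_{k,0},  b(n+1,0) = r b(n,0),  b(n+1,k+1) = (k+1+r) b(n,k+1) + b(n,k).
rStirling2 : ℕ → ℕ → ℕ → ℕ
rStirling2 r zero    zero    = 1
rStirling2 r zero    (suc k) = 0
rStirling2 r (suc n) zero    = r *ℕ rStirling2 r n zero
rStirling2 r (suc n) (suc k) = (suc k +ℕ r) *ℕ rStirling2 r n (suc k) +ℕ rStirling2 r n k

stirling1 : ℕ → ℕ → ℕ
stirling1 = rStirling1 0

stirling2 : ℕ → ℕ → ℕ
stirling2 = rStirling2 0

fallingℤ : ℤ → ℕ → ℤ
fallingℤ x zero    = 1ℤ
fallingℤ x (suc m) = fallingℤ x m * (x - + m)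

sumTo : ℕ → (ℕ → ℤ) → ℤ
sumTo zero    f = f 0
sumTo (suc p) f = sumTo p f + f (suc p)

-- For an r-Stirling triangle T, the sequence m ↦ T(n+m, m) is a polynomial in m of degree 2n.
-- Running its recurrence backwards extends it to a polynomial A on ℤ that vanishes at -1, …, -n,
-- and (-1)ⁿ A(-(n+k+1)) is the binomial convolution of column k of the dual (ordinary) Stirling
-- triangle with (r-1)ᵐ, resp. with the falling factorials (r-1)(r-2)⋯(r-m).  With w = n+k+q and
-- N = w+p+1, the polynomial G(x) = C(x+q, q) C(x+w, k) A(x+q) has degree q+k+2n < N, so its
-- N-th finite difference Σᵢ (-1)ⁱ C(N, i) G(i-w-1) vanishes.  The terms 0 < i ≤ w are zero (roots
-- of the two binomials and of A), the terms i = w+1+j are the left-hand sum, and the term i = 0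
-- is the right-hand side.
module Submission where

open import Defs
open import Function using (_∘_; const)
open import Data.Nat using (ℕ; zero; suc; _≤_; _<_; s≤s; z<s) renaming (_+_ to _+ℕ_; _*_ to _*ℕ_; _∸_ to _∸ℕ_)
import Data.Nat.Properties as ℕ
open import Data.Nat.Combinatorics using (_C_; nCn≡1; nCk≡nC[n∸k]; k>n⇒nCk≡0; nCk+nC[k+1]≡[n+1]C[k+1])
open import Data.Integer using (ℤ; +_; -[1+_]; _+_; _*_; -_; _-_; _⊖_; _^_; 0ℤ; 1ℤ; -1ℤ) renaming (suc to sucℤ)
open import Algebra.Bundles using (Semiring)
import Relation.Binary.Reasoning.Setoid as SetoidReasoning
import Data.Integer.Properties as ℤ
open import Data.Integer.Tactic.RingSolver using (solve-∀)
open import Data.Nat.Tactic.RingSolver using () renaming (solve-∀ to ℕ-solve-∀)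
open import Data.Product using (_×_; _,_)
open import Relation.Binary.PropositionalEquality using (_≡_; refl; sym; trans; cong; cong₂; subst; module ≡-Reasoning)

sumBelow : ℕ → (ℕ → ℤ) → ℤ
sumBelow zero    f = 0ℤ
sumBelow (suc N) f = f 0 + sumBelow N (f ∘ suc)

sumBelow-cong : ∀ N {f g} → (∀ i → i < N → f i ≡ g i) → sumBelow N f ≡ sumBelow N g
sumBelow-cong zero    f≡g = refl
sumBelow-cong (suc N) f≡g = cong₂ _+_ (f≡g 0 z<s) (sumBelow-cong N (λ i i<N → f≡g (suc i) (s≤s i<N)))

sumBelow-zero : ∀ N {f} → (∀ i → i < N → f i ≡ 0ℤ) → sumBelow N f ≡ 0ℤ
sumBelow-zero zero    f≡0 = refl
sumBelow-zero (suc N) f≡0 = cong₂ _+_ (f≡0 0 z<s) (sumBelow-zero N (λ i i<N → f≡0 (suc i) (s≤s i<N)))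

sumBelow-suc : ∀ N f → sumBelow (suc N) f ≡ sumBelow N f + f N
sumBelow-suc zero    f = ℤ.+-comm (f 0) 0ℤ
sumBelow-suc (suc N) f = trans (cong (_+_ (f 0)) (sumBelow-suc N (f ∘ suc))) (sym (ℤ.+-assoc (f 0) _ _))

sumBelow-+ℕ : ∀ a b f → sumBelow (a +ℕ b) f ≡ sumBelow a f + sumBelow b (λ i → f (a +ℕ i))
sumBelow-+ℕ zero    b f = sym (ℤ.+-identityˡ _)
sumBelow-+ℕ (suc a) b f = trans (cong (_+_ (f 0)) (sumBelow-+ℕ a b (f ∘ suc))) (sym (ℤ.+-assoc (f 0) _ _))

sumBelow-+ : ∀ N f g → sumBelow N (λ i → f i + g i) ≡ sumBelow N f + sumBelow N g
sumBelow-+ zero    f g = refl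
sumBelow-+ (suc N) f g =
  trans (cong (_+_ (f 0 + g 0)) (sumBelow-+ N (f ∘ suc) (g ∘ suc))) (interchange (f 0) (g 0) _ _)
  where
  interchange : ∀ a b c d → (a + b) + (c + d) ≡ (a + c) + (b + d)
  interchange = solve-∀

sumBelow-*ˡ : ∀ N c f → sumBelow N (λ i → c * f i) ≡ c * sumBelow N f
sumBelow-*ˡ zero    c f = sym (ℤ.*-zeroʳ c)
sumBelow-*ˡ (suc N) c f =
  trans (cong (_+_ (c * f 0)) (sumBelow-*ˡ N c (f ∘ suc))) (sym (ℤ.*-distribˡ-+ c (f 0) _))

sumBelow-neg : ∀ N f → sumBelow N (λ i → - f i) ≡ - sumBelow N f
sumBelow-neg zero    f = refl
sumBelow-neg (suc N) f =
  trans (cong (_+_ (- f 0)) (sumBelow-neg N (f ∘ suc))) (sym (ℤ.neg-distrib-+ (f 0) _))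

sumTo≡sumBelow : ∀ p f → sumTo p f ≡ sumBelow (suc p) f
sumTo≡sumBelow zero    f = sym (ℤ.+-identityʳ (f 0))
sumTo≡sumBelow (suc p) f = trans (cong (_+ f (suc p)) (sumTo≡sumBelow p f)) (sym (sumBelow-suc (suc p) f))

Δ : (ℕ → ℤ) → ℕ → ℤ
Δ f x = f (suc x) - f x

Δ-+ : ∀ f g x → Δ (λ y → f y + g y) x ≡ Δ f x + Δ g x
Δ-+ f g x = sum-rule (f (suc x)) (f x) (g (suc x)) (g x)
  where
  sum-rule : ∀ a₁ a b₁ b → (a₁ + b₁) - (a + b) ≡ (a₁ - a) + (b₁ - b)
  sum-rule = solve-∀

Δ-* : ∀ f g x → Δ (λ y → f y * g y) x ≡ Δ f x * g (suc x) + f x * Δ g x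
Δ-* f g x = product-rule (f (suc x)) (f x) (g (suc x)) (g x)
  where
  product-rule : ∀ a₁ a b₁ b → a₁ * b₁ - a * b ≡ (a₁ - a) * b₁ + a * (b₁ - b)
  product-rule = solve-∀

data Degree≤ : ℕ → (ℕ → ℤ) → Set where
  Δ≡0    : ∀ {f} → (∀ x → Δ f x ≡ 0ℤ) → Degree≤ 0 f
  Δ-deg≤ : ∀ {d f} → Degree≤ d (Δ f) → Degree≤ (suc d) f

Degree≤-cong : ∀ {d f g} → (∀ x → f x ≡ g x) → Degree≤ d f → Degree≤ d g
Degree≤-cong f≡g (Δ≡0 Δf≡0)  = Δ≡0 (λ x → trans (cong₂ _-_ (sym (f≡g (suc x))) (sym (f≡g x))) (Δf≡0 x))
Degree≤-cong f≡g (Δ-deg≤ Δf) = Δ-deg≤ (Degree≤-cong (λ x → cong₂ _-_ (f≡g (suc x)) (f≡g x)) Δf)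

Degree≤-shift : ∀ {d f} → Degree≤ d f → Degree≤ d (f ∘ suc)
Degree≤-shift (Δ≡0 Δf≡0)  = Δ≡0 (Δf≡0 ∘ suc)
Degree≤-shift (Δ-deg≤ Δf) = Δ-deg≤ (Degree≤-shift Δf)

Degree≤-+ : ∀ {d f g} → Degree≤ d f → Degree≤ d g → Degree≤ d (λ x → f x + g x)
Degree≤-+ {f = f} {g} (Δ≡0 Δf≡0)  (Δ≡0 Δg≡0)  = Δ≡0 (λ x → trans (Δ-+ f g x) (cong₂ _+_ (Δf≡0 x) (Δg≡0 x)))
Degree≤-+ {f = f} {g} (Δ-deg≤ Δf) (Δ-deg≤ Δg) = Δ-deg≤ (Degree≤-cong (λ x → sym (Δ-+ f g x)) (Degree≤-+ Δf Δg))

Δ-*-constˡ : ∀ f g → (∀ x → Δ f x ≡ 0ℤ) → ∀ x → Δ (λ y → f y * g y) x ≡ f x * Δ g x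
Δ-*-constˡ f g Δf≡0 x = begin
  Δ (λ y → f y * g y) x           ≡⟨ Δ-* f g x ⟩
  Δ f x * g (suc x) + f x * Δ g x ≡⟨ cong (λ t → t * g (suc x) + f x * Δ g x) (Δf≡0 x) ⟩
  0ℤ * g (suc x) + f x * Δ g x    ≡⟨ ℤ.+-identityˡ (f x * Δ g x) ⟩
  f x * Δ g x                     ∎
  where open ≡-Reasoning

Δ-*-constʳ : ∀ f g → (∀ x → Δ g x ≡ 0ℤ) → ∀ x → Δ (λ y → f y * g y) x ≡ Δ f x * g (suc x)
Δ-*-constʳ f g Δg≡0 x = begin
  Δ (λ y → f y * g y) x           ≡⟨ Δ-* f g x ⟩
  Δ f x * g (suc x) + f x * Δ g x ≡⟨ cong (λ t → Δ f x * g (suc x) + f x * t) (Δg≡0 x) ⟩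
  Δ f x * g (suc x) + f x * 0ℤ    ≡⟨ cong (_+_ (Δ f x * g (suc x))) (ℤ.*-zeroʳ (f x)) ⟩
  Δ f x * g (suc x) + 0ℤ          ≡⟨ ℤ.+-identityʳ _ ⟩
  Δ f x * g (suc x)               ∎
  where open ≡-Reasoning

Degree≤-* : ∀ {a b f g} → Degree≤ a f → Degree≤ b g → Degree≤ (a +ℕ b) (λ x → f x * g x)
Degree≤-* {f = f} {g} (Δ≡0 Δf≡0) (Δ≡0 Δg≡0) =
  Δ≡0 (λ x → trans (Δ-*-constˡ f g Δf≡0 x) (trans (cong (f x *_) (Δg≡0 x)) (ℤ.*-zeroʳ (f x))))
Degree≤-* {f = f} {g} (Δ≡0 Δf≡0) (Δ-deg≤ Δg) =
  Δ-deg≤ (Degree≤-cong (sym ∘ Δ-*-constˡ f g Δf≡0) (Degree≤-* {f = f} {Δ g} (Δ≡0 Δf≡0) Δg))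
Degree≤-* {f = f} {g} (Δ-deg≤ Δf) (Δ≡0 Δg≡0) =
  Δ-deg≤ (Degree≤-cong (sym ∘ Δ-*-constʳ f g Δg≡0)
    (Degree≤-* {f = Δ f} {g ∘ suc} Δf (Degree≤-shift {f = g} (Δ≡0 Δg≡0))))
Degree≤-* {suc a} {suc b} {f} {g} (Δ-deg≤ Δf) (Δ-deg≤ Δg) =
  Δ-deg≤ (Degree≤-cong (sym ∘ Δ-* f g)
    (Degree≤-+ (Degree≤-* {f = Δ f} {g ∘ suc} Δf (Degree≤-shift {f = g} (Δ-deg≤ Δg)))
               (subst (λ d → Degree≤ d (λ x → f x * Δ g x)) (sym (ℕ.+-suc a b))
                      (Degree≤-* {f = f} {Δ g} (Δ-deg≤ Δf) Δg))))

binomialConv : ℕ → (ℕ → ℤ) → (ℕ → ℤ) → ℤ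
binomialConv M a b = sumBelow (suc M) (λ i → + (M C i) * a i * b (M ∸ℕ i))

binomialConv-suc : ∀ M a b →
  binomialConv (suc M) a b ≡ binomialConv M a (b ∘ suc) + binomialConv M (a ∘ suc) b
binomialConv-suc M a b = begin
  binomialConv (suc M) a b
    -- + 1 * a 0 * b (suc M) is the i = 0 summand, as it reduces
    ≡⟨ cong (_+_ (+ 1 * a 0 * b (suc M))) pascal ⟩
  + 1 * a 0 * b (suc M) + (sumBelow (suc M) upper + binomialConv M (a ∘ suc) b)
    ≡⟨ sym (ℤ.+-assoc (+ 1 * a 0 * b (suc M)) _ _) ⟩
  sumBelow (suc (suc M)) extended + binomialConv M (a ∘ suc) b
    ≡⟨ cong (_+ binomialConv M (a ∘ suc) b) drop-last ⟩
  sumBelow (suc M) extended + binomialConv M (a ∘ suc) b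
    ≡⟨ cong (_+ binomialConv M (a ∘ suc) b) (sumBelow-cong (suc M) extended≡) ⟩
  binomialConv M a (b ∘ suc) + binomialConv M (a ∘ suc) b ∎
  where
  open ≡-Reasoning
  upper extended : ℕ → ℤ
  upper i = + (M C suc i) * a (suc i) * b (M ∸ℕ i)
  extended i = + (M C i) * a i * b (suc M ∸ℕ i)
  pascal : sumBelow (suc M) (λ i → + (suc M C suc i) * a (suc i) * b (M ∸ℕ i))
         ≡ sumBelow (suc M) upper + binomialConv M (a ∘ suc) b
  pascal = trans (sumBelow-cong (suc M) (λ i _ → split i))
                 (sumBelow-+ (suc M) upper (λ i → + (M C i) * a (suc i) * b (M ∸ℕ i)))
    where
    distrib : ∀ c d x y → (c + d) * x * y ≡ d * x * y + c * x * y
    distrib = solve-∀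
    split : ∀ i → + (suc M C suc i) * a (suc i) * b (M ∸ℕ i)
                ≡ upper i + + (M C i) * a (suc i) * b (M ∸ℕ i)
    split i = trans (cong (λ c → + c * a (suc i) * b (M ∸ℕ i)) (sym (nCk+nC[k+1]≡[n+1]C[k+1] M i)))
                    (distrib (+ (M C i)) (+ (M C suc i)) (a (suc i)) (b (M ∸ℕ i)))
  drop-last : sumBelow (suc (suc M)) extended ≡ sumBelow (suc M) extended
  drop-last = begin
    sumBelow (suc (suc M)) extended                     ≡⟨ sumBelow-suc (suc M) extended ⟩
    sumBelow (suc M) extended + extended (suc M)
      ≡⟨ cong (λ c → sumBelow (suc M) extended + + c * a (suc M) * b (M ∸ℕ M)) (k>n⇒nCk≡0 (ℕ.n<1+n M)) ⟩
    sumBelow (suc M) extended + 0ℤ * a (suc M) * b (M ∸ℕ M)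
      ≡⟨ ℤ.+-identityʳ _ ⟩
    sumBelow (suc M) extended                           ∎
  extended≡ : ∀ i → i < suc M → extended i ≡ + (M C i) * a i * b (suc (M ∸ℕ i))
  extended≡ i (s≤s i≤M) = cong (λ m → + (M C i) * a i * b m) (ℕ.+-∸-assoc 1 i≤M)

alternatingSum : ℕ → (ℕ → ℤ) → ℤ
alternatingSum N f = binomialConv N (λ i → (-1ℤ ^ i) * f i) (const 1ℤ)

alternatingSum-suc : ∀ N f → alternatingSum (suc N) f ≡ - alternatingSum N (Δ f)
alternatingSum-suc N f = begin
  alternatingSum (suc N) f
    ≡⟨ binomialConv-suc N (λ i → (-1ℤ ^ i) * f i) (const 1ℤ) ⟩
  sumBelow (suc N) (term f) + sumBelow (suc N) next
    ≡⟨ sym (sumBelow-+ (suc N) (term f) next) ⟩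
  sumBelow (suc N) (λ i → term f i + next i)
    ≡⟨ sumBelow-cong (suc N) (λ i _ → step (+ (N C i)) (-1ℤ ^ i) (f (suc i)) (f i)) ⟩
  sumBelow (suc N) (λ i → - term (Δ f) i)
    ≡⟨ sumBelow-neg (suc N) (term (Δ f)) ⟩
  - alternatingSum N (Δ f) ∎
  where
  open ≡-Reasoning
  term : (ℕ → ℤ) → ℕ → ℤ
  term g i = + (N C i) * ((-1ℤ ^ i) * g i) * 1ℤ
  next : ℕ → ℤ
  next i = + (N C i) * ((-1ℤ ^ suc i) * f (suc i)) * 1ℤ
  step : ∀ c s y x → c * (s * x) * 1ℤ + c * (-1ℤ * s * y) * 1ℤ ≡ - (c * (s * (y - x)) * 1ℤ)
  step = solve-∀

alternatingSum-zero : ∀ N f → (∀ x → f x ≡ 0ℤ) → alternatingSum N f ≡ 0ℤ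
alternatingSum-zero N f f≡0 = sumBelow-zero (suc N) (λ i _ → vanish i)
  where
  vanish : ∀ i → + (N C i) * ((-1ℤ ^ i) * f i) * 1ℤ ≡ 0ℤ
  vanish i rewrite f≡0 i | ℤ.*-zeroʳ (-1ℤ ^ i) | ℤ.*-zeroʳ (+ (N C i)) = refl

alternatingSum-vanishes : ∀ {d f} N → Degree≤ d f → d < N → alternatingSum N f ≡ 0ℤ
alternatingSum-vanishes {f = f} (suc N) (Δ≡0 Δf≡0) _ =
  trans (alternatingSum-suc N f) (cong -_ (alternatingSum-zero N (Δ f) Δf≡0))
alternatingSum-vanishes {f = f} (suc N) (Δ-deg≤ Δf) (s≤s d<N) =
  trans (alternatingSum-suc N f) (cong -_ (alternatingSum-vanishes N Δf d<N))

Degree≤ℤ : ℕ → (ℤ → ℤ) → Set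
Degree≤ℤ d F = ∀ c → Degree≤ d (λ u → F (+ u + c))

Degree≤ℤ-suc : ∀ {d} F → Degree≤ℤ d (λ x → F (sucℤ x) - F x) → Degree≤ℤ (suc d) F
Degree≤ℤ-suc F ΔF c =
  Δ-deg≤ (Degree≤-cong (λ u → cong (λ y → F y - F (+ u + c)) (sym (ℤ.+-assoc 1ℤ (+ u) c))) (ΔF c))

Degree≤ℤ-translate : ∀ {d} F a → Degree≤ℤ d F → Degree≤ℤ d (λ x → F (x + a))
Degree≤ℤ-translate F a dF c = Degree≤-cong (λ u → cong F (sym (ℤ.+-assoc (+ u) c a))) (dF (c + a))

Degree≤ℤ-* : ∀ {a b} F G → Degree≤ℤ a F → Degree≤ℤ b G → Degree≤ℤ (a +ℕ b) (λ x → F x * G x)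
Degree≤ℤ-* F G dF dG c = Degree≤-* {f = λ u → F (+ u + c)} {g = λ u → G (+ u + c)} (dF c) (dG c)

Degree≤ℤ-affine : ∀ a → Degree≤ℤ 1 (λ x → 1ℤ + x + a)
Degree≤ℤ-affine a = Degree≤ℤ-suc (λ x → 1ℤ + x + a)
  (λ c → Degree≤-cong (λ u → sym (slope (+ u + c) a)) (Δ≡0 (λ _ → refl)))
  where
  slope : ∀ x a → (1ℤ + (1ℤ + x) + a) - (1ℤ + x + a) ≡ 1ℤ
  slope = solve-∀

-- The negative branch is upper negation: C(-1-m, k) = (-1)ᵏ C(m+k, k).
binomialℤ : ℤ → ℕ → ℤ
binomialℤ (+ m)    k = + (m C k)
binomialℤ -[1+ m ] k = (-1ℤ ^ k) * + ((m +ℕ k) C k)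

binomialℤ-zero : ∀ x → binomialℤ x 0 ≡ 1ℤ
binomialℤ-zero (+ m)    = refl
binomialℤ-zero -[1+ m ] = refl

binomialℤ-pascal : ∀ x k → binomialℤ (sucℤ x) (suc k) ≡ binomialℤ x (suc k) + binomialℤ x k
binomialℤ-pascal (+ m) k = begin
  + (suc m C suc k)             ≡⟨ cong +_ (sym (nCk+nC[k+1]≡[n+1]C[k+1] m k)) ⟩
  + (m C k) + + (m C suc k)     ≡⟨ ℤ.+-comm (+ (m C k)) (+ (m C suc k)) ⟩
  + (m C suc k) + + (m C k)     ∎
  where open ≡-Reasoning
binomialℤ-pascal -[1+ zero ] k = sym (begin
  -1ℤ * s * + (suc k C suc k) + s * + (k C k) ≡⟨ cong₂ (λ a b → -1ℤ * s * + a + s * + b) (nCn≡1 (suc k)) (nCn≡1 k) ⟩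
  -1ℤ * s * 1ℤ + s * 1ℤ                       ≡⟨ cancel s ⟩
  0ℤ                                          ∎)
  where
  open ≡-Reasoning
  s = -1ℤ ^ k
  cancel : ∀ s → -1ℤ * s * 1ℤ + s * 1ℤ ≡ 0ℤ
  cancel = solve-∀
binomialℤ-pascal -[1+ suc m ] k = begin
  -1ℤ * s * + B
    ≡⟨ split s (+ A) (+ B) ⟩
  -1ℤ * s * (+ A + + B) + s * + A
    ≡⟨ cong (λ c → -1ℤ * s * + c + s * + A) (nCk+nC[k+1]≡[n+1]C[k+1] (m +ℕ suc k) k) ⟩
  -1ℤ * s * + (suc (m +ℕ suc k) C suc k) + s * + A
    ≡⟨ cong (λ n → -1ℤ * s * + (suc (m +ℕ suc k) C suc k) + s * + (n C k)) (ℕ.+-suc m k) ⟩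
  -1ℤ * s * + ((suc m +ℕ suc k) C suc k) + s * + ((suc m +ℕ k) C k) ∎
  where
  open ≡-Reasoning
  s = -1ℤ ^ k
  A = (m +ℕ suc k) C k
  B = (m +ℕ suc k) C suc k
  split : ∀ s a b → -1ℤ * s * b ≡ -1ℤ * s * (a + b) + s * a
  split = solve-∀

Degree≤ℤ-binomialℤ : ∀ k → Degree≤ℤ k (λ x → binomialℤ x k)
Degree≤ℤ-binomialℤ zero    c = Degree≤-cong (λ u → sym (binomialℤ-zero (+ u + c))) (Δ≡0 (λ _ → refl))
Degree≤ℤ-binomialℤ (suc k) = Degree≤ℤ-suc (λ x → binomialℤ x (suc k))
  (λ c → Degree≤-cong (λ u → Δ-binomialℤ (+ u + c)) (Degree≤ℤ-binomialℤ k c))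
  where
  Δ-binomialℤ : ∀ x → binomialℤ x k ≡ binomialℤ (sucℤ x) (suc k) - binomialℤ x (suc k)
  Δ-binomialℤ x = trans (sym (cancel (binomialℤ x (suc k)) (binomialℤ x k)))
                        (cong (_- binomialℤ x (suc k)) (sym (binomialℤ-pascal x k)))
    where
    cancel : ∀ a b → (a + b) - a ≡ b
    cancel = solve-∀

module LowerTriangular {c ℓ} (R : Semiring c ℓ) (T γ : ℕ → ℕ → Semiring.Carrier R) where
  open Semiring R renaming (_+_ to _+ᴿ_; _*_ to _*ᴿ_)
  open SetoidReasoning setoid

  module _ (T-top : ∀ k → T 0 (suc k) ≈ 0#)
           (T-rec : ∀ M k → T (suc M) (suc k) ≈ γ M k *ᴿ T M (suc k) +ᴿ T M k) where

    above-diagonal : ∀ {M k} → M < k → T M k ≈ 0#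
    above-diagonal {zero}  {suc k} _         = T-top k
    above-diagonal {suc M} {suc k} (s≤s M<k) = begin
      T (suc M) (suc k)               ≈⟨ T-rec M k ⟩
      γ M k *ᴿ T M (suc k) +ᴿ T M k   ≈⟨ +-cong (*-congˡ (above-diagonal (ℕ.m<n⇒m<1+n M<k))) (above-diagonal M<k) ⟩
      γ M k *ᴿ 0# +ᴿ 0#               ≈⟨ +-identityʳ _ ⟩
      γ M k *ᴿ 0#                     ≈⟨ zeroʳ _ ⟩
      0#                              ∎

    diagonal : T 0 0 ≈ 1# → ∀ k → T k k ≈ 1#
    diagonal T₀₀ zero    = T₀₀
    diagonal T₀₀ (suc k) = begin
      T (suc k) (suc k)               ≈⟨ T-rec k k ⟩
      γ k k *ᴿ T k (suc k) +ᴿ T k k   ≈⟨ +-cong (*-congˡ (above-diagonal (ℕ.n<1+n k))) (diagonal T₀₀ k) ⟩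
      γ k k *ᴿ 0# +ᴿ 1#               ≈⟨ +-congʳ (zeroʳ _) ⟩
      0# +ᴿ 1#                        ≈⟨ +-identityˡ _ ⟩
      1#                              ∎

binomialConv-recurrence : ∀ M a a′ b (σ β : ℕ → ℤ) γ →
  (∀ i → a (suc i) ≡ a′ i - σ i * a i) → (∀ m → b (suc m) ≡ b m * β m) →
  (∀ i → i ≤ M → β (M ∸ℕ i) - σ i ≡ γ) →
  binomialConv (suc M) a b ≡ γ * binomialConv M a b + binomialConv M a′ b
binomialConv-recurrence M a a′ b σ β γ a-rec b-rec β-σ≡γ = begin
  binomialConv (suc M) a b
    ≡⟨ binomialConv-suc M a b ⟩
  binomialConv M a (b ∘ suc) + binomialConv M (a ∘ suc) b
    ≡⟨ sym (sumBelow-+ (suc M) (λ i → c i * a i * b (suc (M ∸ℕ i))) (term (a ∘ suc))) ⟩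
  sumBelow (suc M) (λ i → c i * a i * b (suc (M ∸ℕ i)) + c i * a (suc i) * b (M ∸ℕ i))
    ≡⟨ sumBelow-cong (suc M) termwise ⟩
  sumBelow (suc M) (λ i → γ * term a i + term a′ i)
    ≡⟨ sumBelow-+ (suc M) (λ i → γ * term a i) (term a′) ⟩
  sumBelow (suc M) (λ i → γ * term a i) + binomialConv M a′ b
    ≡⟨ cong (_+ binomialConv M a′ b) (sumBelow-*ˡ (suc M) γ (term a)) ⟩
  γ * binomialConv M a b + binomialConv M a′ b ∎
  where
  open ≡-Reasoning
  c : ℕ → ℤ
  c i = + (M C i)
  term : (ℕ → ℤ) → ℕ → ℤ
  term f i = c i * f i * b (M ∸ℕ i)
  regroup : ∀ c x x′ y β σ → c * x * (y * β) + c * (x′ - σ * x) * y ≡ (β - σ) * (c * x * y) + c * x′ * y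
  regroup = solve-∀
  termwise : ∀ i → i < suc M → c i * a i * b (suc (M ∸ℕ i)) + c i * a (suc i) * b (M ∸ℕ i)
                               ≡ γ * term a i + term a′ i
  termwise i (s≤s i≤M) = begin
    c i * a i * b (suc (M ∸ℕ i)) + c i * a (suc i) * b (M ∸ℕ i)
      ≡⟨ cong₂ (λ y x → c i * a i * y + c i * x * b (M ∸ℕ i)) (b-rec (M ∸ℕ i)) (a-rec i) ⟩
    c i * a i * (b (M ∸ℕ i) * β (M ∸ℕ i)) + c i * (a′ i - σ i * a i) * b (M ∸ℕ i)
      ≡⟨ regroup (c i) (a i) (a′ i) (b (M ∸ℕ i)) (β (M ∸ℕ i)) (σ i) ⟩
    (β (M ∸ℕ i) - σ i) * term a i + term a′ i
      ≡⟨ cong (λ g → g * term a i + term a′ i) (β-σ≡γ i i≤M) ⟩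
    γ * term a i + term a′ i ∎

binomialConv-zeroˡ : ∀ M b → binomialConv M (const 0ℤ) b ≡ 0ℤ
binomialConv-zeroˡ M b = sumBelow-zero (suc M) (λ i _ → vanish i)
  where
  vanish : ∀ i → + (M C i) * 0ℤ * b (M ∸ℕ i) ≡ 0ℤ
  vanish i rewrite ℤ.*-zeroʳ (+ (M C i)) = refl

-1^m*-1^m≡1 : ∀ m → (-1ℤ ^ m) * (-1ℤ ^ m) ≡ 1ℤ
-1^m*-1^m≡1 zero    = refl
-1^m*-1^m≡1 (suc m) = trans (square (-1ℤ ^ m)) (-1^m*-1^m≡1 m)
  where
  square : ∀ s → (-1ℤ * s) * (-1ℤ * s) ≡ s * s
  square = solve-∀

-1^[m+n+n]≡-1^m : ∀ m n → -1ℤ ^ (m +ℕ n +ℕ n) ≡ -1ℤ ^ m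
-1^[m+n+n]≡-1^m m n = begin
  -1ℤ ^ (m +ℕ n +ℕ n)                    ≡⟨ ℤ.^-distribˡ-+-* -1ℤ (m +ℕ n) n ⟩
  -1ℤ ^ (m +ℕ n) * -1ℤ ^ n               ≡⟨ cong (_* -1ℤ ^ n) (ℤ.^-distribˡ-+-* -1ℤ m n) ⟩
  -1ℤ ^ m * -1ℤ ^ n * -1ℤ ^ n            ≡⟨ ℤ.*-assoc (-1ℤ ^ m) (-1ℤ ^ n) (-1ℤ ^ n) ⟩
  -1ℤ ^ m * (-1ℤ ^ n * -1ℤ ^ n)          ≡⟨ cong (-1ℤ ^ m *_) (-1^m*-1^m≡1 n) ⟩
  -1ℤ ^ m * 1ℤ                           ≡⟨ ℤ.*-identityʳ (-1ℤ ^ m) ⟩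
  -1ℤ ^ m                                ∎
  where open ≡-Reasoning

-1^[m+n]*-1^n≡-1^m : ∀ m n → (-1ℤ ^ (m +ℕ n)) * (-1ℤ ^ n) ≡ -1ℤ ^ m
-1^[m+n]*-1^n≡-1^m m n = trans (sym (ℤ.^-distribˡ-+-* -1ℤ (m +ℕ n) n)) (-1^[m+n+n]≡-1^m m n)

x-sy≡0⇒y≡sx : ∀ s x y → s * s ≡ 1ℤ → x + -1ℤ * s * y ≡ 0ℤ → y ≡ s * x
x-sy≡0⇒y≡sx s x y s²≡1 x-sy≡0 = begin
  y                                                        ≡⟨ expand s x y ⟩
  s * x - s * (x + -1ℤ * s * y) - (s * s - 1ℤ) * y         ≡⟨ cong₂ (λ a b → s * x - s * a - (b - 1ℤ) * y) x-sy≡0 s²≡1 ⟩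
  s * x - s * 0ℤ - (1ℤ - 1ℤ) * y                           ≡⟨ simplify s x y ⟩
  s * x                                                    ∎
  where
  open ≡-Reasoning
  expand : ∀ s x y → y ≡ s * x - s * (x + -1ℤ * s * y) - (s * s - 1ℤ) * y
  expand = solve-∀
  simplify : ∀ s x y → s * x - s * 0ℤ - (1ℤ - 1ℤ) * y ≡ s * x
  simplify = solve-∀

signedColumn : (ℕ → ℕ → ℕ) → ℕ → ℕ → ℤ
signedColumn S k i = (-1ℤ ^ (i +ℕ k)) * + S i k

module StirlingConvolution
  (S σ : ℕ → ℕ → ℕ) (S-top : ∀ k → S 0 (suc k) ≡ 0) (S₀₀ : S 0 0 ≡ 1)
  (S-rec₀ : ∀ i → S (suc i) 0 ≡ σ i 0 *ℕ S i 0)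
  (S-rec : ∀ i k → S (suc i) (suc k) ≡ σ i (suc k) *ℕ S i (suc k) +ℕ S i k)
  (b β : ℕ → ℤ) (b₀ : b 0 ≡ 1ℤ) (b-rec : ∀ m → b (suc m) ≡ b m * β m)
  (γ : ℕ → ℕ → ℤ) (β-σ≡γ : ∀ M k i → i ≤ M → β (M ∸ℕ i) - + σ i k ≡ γ M k) where

  convolution : ℕ → ℕ → ℤ
  convolution M k = binomialConv M (signedColumn S k) b

  convolution-suc₀ : ∀ M → convolution (suc M) 0 ≡ γ M 0 * convolution M 0
  convolution-suc₀ M = begin
    convolution (suc M) 0
      ≡⟨ binomialConv-recurrence M (signedColumn S 0) (const 0ℤ) b (λ i → + σ i 0) β (γ M 0)
                                 column-rec b-rec (β-σ≡γ M 0) ⟩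
    γ M 0 * convolution M 0 + binomialConv M (const 0ℤ) b
      ≡⟨ cong (_+_ (γ M 0 * convolution M 0)) (binomialConv-zeroˡ M b) ⟩
    γ M 0 * convolution M 0 + 0ℤ
      ≡⟨ ℤ.+-identityʳ _ ⟩
    γ M 0 * convolution M 0 ∎
    where
    open ≡-Reasoning
    sign-flip : ∀ t σ S → -1ℤ * t * (σ * S) ≡ 0ℤ - σ * (t * S)
    sign-flip = solve-∀
    column-rec : ∀ i → signedColumn S 0 (suc i) ≡ 0ℤ - + σ i 0 * signedColumn S 0 i
    column-rec i =
      trans (cong (λ s → -1ℤ * -1ℤ ^ (i +ℕ 0) * s) (trans (cong +_ (S-rec₀ i)) (ℤ.pos-* (σ i 0) (S i 0))))
            (sign-flip (-1ℤ ^ (i +ℕ 0)) (+ σ i 0) (+ S i 0))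

  convolution-suc : ∀ M k → convolution (suc M) (suc k) ≡ γ M (suc k) * convolution M (suc k) + convolution M k
  convolution-suc M k =
    binomialConv-recurrence M (signedColumn S (suc k)) (signedColumn S k) b (λ i → + σ i (suc k)) β (γ M (suc k))
                            column-rec b-rec (β-σ≡γ M (suc k))
    where
    sign-flip : ∀ t σ S₁ S₀ → -1ℤ * (-1ℤ * t) * (σ * S₁ + S₀) ≡ t * S₀ - σ * ((-1ℤ * t) * S₁)
    sign-flip = solve-∀
    column-rec : ∀ i → signedColumn S (suc k) (suc i)
                     ≡ signedColumn S k i - + σ i (suc k) * signedColumn S (suc k) i
    column-rec i = begin
      -1ℤ * -1ℤ ^ (i +ℕ suc k) * + S (suc i) (suc k)
        ≡⟨ cong₂ (λ t s → -1ℤ * t * s) (cong (-1ℤ ^_) (ℕ.+-suc i k))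
                                       (trans (cong +_ (S-rec i k)) (ℤ.pos-+ (σ i (suc k) *ℕ S i (suc k)) (S i k))) ⟩
      -1ℤ * (-1ℤ * t) * (+ (σ i (suc k) *ℕ S i (suc k)) + + S i k)
        ≡⟨ cong (λ s → -1ℤ * (-1ℤ * t) * (s + + S i k)) (ℤ.pos-* (σ i (suc k)) (S i (suc k))) ⟩
      -1ℤ * (-1ℤ * t) * (+ σ i (suc k) * + S i (suc k) + + S i k)
        ≡⟨ sign-flip t (+ σ i (suc k)) (+ S i (suc k)) (+ S i k) ⟩
      t * + S i k - + σ i (suc k) * ((-1ℤ * t) * + S i (suc k))
        ≡⟨ cong (λ e → t * + S i k - + σ i (suc k) * (-1ℤ ^ e * + S i (suc k))) (sym (ℕ.+-suc i k)) ⟩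
      signedColumn S k i - + σ i (suc k) * signedColumn S (suc k) i ∎
      where
      open ≡-Reasoning
      t = -1ℤ ^ (i +ℕ k)

  convolution-diagonal : ∀ k → convolution k k ≡ 1ℤ
  convolution-diagonal = diagonal convolution-top convolution-suc convolution₀₀
    where
    open LowerTriangular ℤ.+-*-semiring convolution (λ M k → γ M (suc k))
    vanish : ∀ s y → + 1 * (s * 0ℤ) * y + 0ℤ ≡ 0ℤ
    vanish = solve-∀
    convolution-top : ∀ k → convolution 0 (suc k) ≡ 0ℤ
    convolution-top k rewrite S-top k = vanish (-1ℤ ^ suc k) (b 0)
    convolution₀₀ : convolution 0 0 ≡ 1ℤ
    convolution₀₀ rewrite S₀₀ | b₀ = refl

  sumTo≡convolution : ∀ n k → sumTo n (λ j → (-1ℤ ^ j) * + ((n +ℕ k) C (j +ℕ k)) * + S (j +ℕ k) k * b (n ∸ℕ j))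
                  ≡ convolution (n +ℕ k) k
  sumTo≡convolution n k = begin
    sumTo n summand                                              ≡⟨ sumTo≡sumBelow n summand ⟩
    sumBelow (suc n) summand                                     ≡⟨ sumBelow-cong (suc n) (λ j _ → sym (term-shift j)) ⟩
    sumBelow (suc n) (λ j → term (k +ℕ j))                       ≡⟨ sym (ℤ.+-identityˡ _) ⟩
    0ℤ + sumBelow (suc n) (λ j → term (k +ℕ j))                  ≡⟨ cong (_+ sumBelow (suc n) (λ j → term (k +ℕ j)))
                                                                         (sym (sumBelow-zero k {term} term-below)) ⟩
    sumBelow k term + sumBelow (suc n) (λ j → term (k +ℕ j))    ≡⟨ sym (sumBelow-+ℕ k (suc n) term) ⟩
    sumBelow (k +ℕ suc n) term                                   ≡⟨ cong (λ N → sumBelow N term) (k+[1+n]≡1+[n+k] k n) ⟩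
    convolution (n +ℕ k) k                                       ∎
    where
    open ≡-Reasoning
    open LowerTriangular ℕ.+-*-semiring S (λ i k → σ i (suc k)) using (above-diagonal)
    k+[1+n]≡1+[n+k] : ∀ k n → k +ℕ suc n ≡ suc (n +ℕ k)
    k+[1+n]≡1+[n+k] = ℕ-solve-∀
    summand term : ℕ → ℤ
    summand j = (-1ℤ ^ j) * + ((n +ℕ k) C (j +ℕ k)) * + S (j +ℕ k) k * b (n ∸ℕ j)
    term i = + ((n +ℕ k) C i) * signedColumn S k i * b ((n +ℕ k) ∸ℕ i)
    term-below : ∀ i → i < k → term i ≡ 0ℤ
    term-below i i<k rewrite above-diagonal S-top S-rec i<k
                           | ℤ.*-zeroʳ (-1ℤ ^ (i +ℕ k))
                           | ℤ.*-zeroʳ (+ ((n +ℕ k) C i)) = refl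
    rearrange : ∀ c s x y → c * (s * x) * y ≡ s * c * x * y
    rearrange = solve-∀
    term-shift : ∀ j → term (k +ℕ j) ≡ summand j
    term-shift j = begin
      term (k +ℕ j)
        ≡⟨ cong term (ℕ.+-comm k j) ⟩
      + ((n +ℕ k) C (j +ℕ k)) * ((-1ℤ ^ (j +ℕ k +ℕ k)) * + S (j +ℕ k) k) * b ((n +ℕ k) ∸ℕ (j +ℕ k))
        ≡⟨ cong₂ (λ s m → + ((n +ℕ k) C (j +ℕ k)) * (s * + S (j +ℕ k) k) * b m)
                 (-1^[m+n+n]≡-1^m j k)
                 (trans (cong₂ _∸ℕ_ (ℕ.+-comm n k) (ℕ.+-comm j k)) (ℕ.[m+n]∸[m+o]≡n∸o k n j)) ⟩
      + ((n +ℕ k) C (j +ℕ k)) * ((-1ℤ ^ j) * + S (j +ℕ k) k) * b (n ∸ℕ j)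
        ≡⟨ rearrange (+ ((n +ℕ k) C (j +ℕ k))) (-1ℤ ^ j) (+ S (j +ℕ k) k) (b (n ∸ℕ j)) ⟩
      summand j ∎

[+m]-[+n]≡-[1+n∸1+m] : ∀ {m n} → m < n → + m - + n ≡ -[1+ (n ∸ℕ suc m) ]
[+m]-[+n]≡-[1+n∸1+m] {m} {suc n} (s≤s m≤n) = begin
  + m - + suc n          ≡⟨ ℤ.[+m]-[+n]≡m⊖n m (suc n) ⟩
  m ⊖ suc n              ≡⟨ ℤ.⊖-< (s≤s m≤n) ⟩
  - + (suc n ∸ℕ m)       ≡⟨ cong (λ d → - + d) (ℕ.+-∸-assoc 1 m≤n) ⟩
  -[1+ (n ∸ℕ m) ]        ∎
  where open ≡-Reasoning

module PolynomialExtension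
  (T : ℕ → ℕ → ℕ) (ρ : ℕ → ℕ) (T-diag : ∀ m → T m m ≡ 1)
  (T-rec₀ : ∀ n → T (suc n) 0 ≡ ρ n *ℕ T n 0)
  (T-rec : ∀ n m → T (suc (n +ℕ suc m)) (suc m)
                  ≡ (suc m +ℕ ρ n) *ℕ T (n +ℕ suc m) (suc m) +ℕ T (n +ℕ suc m) m)
  where

  coefficient : ℕ → ℤ → ℤ
  coefficient n x = 1ℤ + x + + ρ n

  -- On negative arguments the clauses solve extension-rec for extension (suc n) x.
  extension : ℕ → ℤ → ℤ
  extension n       (+ m)        = + T (n +ℕ m) m
  extension zero    -[1+ d ]     = 1ℤ
  extension (suc n) -[1+ zero ]  = + T (suc n) 0 - coefficient n -1ℤ * + T n 0
  extension (suc n) -[1+ suc d ] = extension (suc n) -[1+ d ] - coefficient n -[1+ suc d ] * extension n -[1+ d ]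

  private
    a≡[a-c*b]+c*b : ∀ a c b → a ≡ (a - c * b) + c * b
    a≡[a-c*b]+c*b = solve-∀

  extension-+0 : ∀ n → extension n (+ 0) ≡ + T n 0
  extension-+0 n = cong (λ m → + T m 0) (ℕ.+-identityʳ n)

  extension-rec : ∀ n x → extension (suc n) (sucℤ x)
                        ≡ extension (suc n) x + coefficient n x * extension n (sucℤ x)
  extension-rec n (+ m) = begin
    + T (suc (n +ℕ suc m)) (suc m)
      ≡⟨ cong +_ (T-rec n m) ⟩
    + ((suc m +ℕ ρ n) *ℕ T (n +ℕ suc m) (suc m) +ℕ T (n +ℕ suc m) m)
      ≡⟨ ℤ.pos-+ ((suc m +ℕ ρ n) *ℕ T (n +ℕ suc m) (suc m)) (T (n +ℕ suc m) m) ⟩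
    + ((suc m +ℕ ρ n) *ℕ T (n +ℕ suc m) (suc m)) + + T (n +ℕ suc m) m
      ≡⟨ cong₂ _+_ (ℤ.pos-* (suc m +ℕ ρ n) (T (n +ℕ suc m) (suc m))) (cong (λ i → + T i m) (ℕ.+-suc n m)) ⟩
    + (suc m +ℕ ρ n) * + T (n +ℕ suc m) (suc m) + + T (suc n +ℕ m) m
      ≡⟨ ℤ.+-comm (+ (suc m +ℕ ρ n) * + T (n +ℕ suc m) (suc m)) (+ T (suc n +ℕ m) m) ⟩
    + T (suc n +ℕ m) m + coefficient n (+ m) * + T (n +ℕ suc m) (suc m) ∎
    where open ≡-Reasoning
  extension-rec n -[1+ zero ] = begin
    + T (suc n +ℕ 0) 0
      ≡⟨ extension-+0 (suc n) ⟩
    + T (suc n) 0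
      ≡⟨ a≡[a-c*b]+c*b (+ T (suc n) 0) (coefficient n -1ℤ) (+ T n 0) ⟩
    extension (suc n) -1ℤ + coefficient n -1ℤ * + T n 0
      ≡⟨ cong (λ a → extension (suc n) -1ℤ + coefficient n -1ℤ * a) (sym (extension-+0 n)) ⟩
    extension (suc n) -1ℤ + coefficient n -1ℤ * extension n (+ 0) ∎
    where open ≡-Reasoning
  extension-rec n -[1+ suc d ] =
    a≡[a-c*b]+c*b (extension (suc n) -[1+ d ]) (coefficient n -[1+ suc d ]) (extension n -[1+ d ])

  extension-zero : ∀ x → extension 0 x ≡ 1ℤ
  extension-zero (+ m)    = cong +_ (T-diag m)
  extension-zero -[1+ m ] = refl

  extension-roots : ∀ {n d} → d < n → extension n -[1+ d ] ≡ 0ℤ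
  extension-roots {suc n} {zero} _ = begin
    + T (suc n) 0 - + ρ n * + T n 0
      ≡⟨ cong (_- + ρ n * + T n 0) (trans (cong +_ (T-rec₀ n)) (ℤ.pos-* (ρ n) (T n 0))) ⟩
    + ρ n * + T n 0 - + ρ n * + T n 0
      ≡⟨ ℤ.+-inverseʳ (+ ρ n * + T n 0) ⟩
    0ℤ ∎
    where open ≡-Reasoning
  extension-roots {suc n} {suc d} (s≤s d<n) = begin
    extension (suc n) -[1+ d ] - c * extension n -[1+ d ]
      ≡⟨ cong₂ (λ a b → a - c * b) (extension-roots (ℕ.m<n⇒m<1+n d<n)) (extension-roots d<n) ⟩
    0ℤ - c * 0ℤ
      ≡⟨ cong (_-_ 0ℤ) (ℤ.*-zeroʳ c) ⟩
    0ℤ ∎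
    where
    open ≡-Reasoning
    c = coefficient n -[1+ suc d ]

  Degree≤ℤ-extension : ∀ n → Degree≤ℤ (n +ℕ n) (extension n)
  Degree≤ℤ-extension zero c = Degree≤-cong (λ u → sym (extension-zero (+ u + c))) (Δ≡0 (λ _ → refl))
  Degree≤ℤ-extension (suc n) = Degree≤ℤ-suc (extension (suc n))
    (subst (λ d → Degree≤ℤ d (λ x → extension (suc n) (sucℤ x) - extension (suc n) x))
           (sym (ℕ.+-suc n n))
      (λ c → Degree≤-cong (λ u → sym (Δ-extension (+ u + c)))
        (Degree≤ℤ-* (coefficient n) (λ x → extension n (x + 1ℤ))
          (Degree≤ℤ-affine (+ ρ n)) (Degree≤ℤ-translate (extension n) 1ℤ (Degree≤ℤ-extension n)) c)))
    where
    cancel : ∀ a b → (a + b) - a ≡ b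
    cancel = solve-∀
    Δ-extension : ∀ x → extension (suc n) (sucℤ x) - extension (suc n) x
                      ≡ coefficient n x * extension n (x + 1ℤ)
    Δ-extension x = begin
      extension (suc n) (sucℤ x) - extension (suc n) x
        ≡⟨ cong (_- extension (suc n) x) (extension-rec n x) ⟩
      extension (suc n) x + coefficient n x * extension n (sucℤ x) - extension (suc n) x
        ≡⟨ cancel (extension (suc n) x) _ ⟩
      coefficient n x * extension n (1ℤ + x)
        ≡⟨ cong (λ y → coefficient n x * extension n y) (ℤ.+-comm 1ℤ x) ⟩
      coefficient n x * extension n (x + 1ℤ) ∎
      where open ≡-Reasoning

  module _ (W γ : ℕ → ℕ → ℤ) (W-diag : ∀ k → W k k ≡ 1ℤ)
           (W-suc₀ : ∀ M → W (suc M) 0 ≡ γ M 0 * W M 0)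
           (W-suc : ∀ M k → W (suc M) (suc k) ≡ γ M (suc k) * W M (suc k) + W M k)
           (coefficient≡γ : ∀ n k → coefficient n -[1+ suc (n +ℕ k) ] ≡ γ (n +ℕ k) k) where

    extension-at-negative : ∀ n k → (-1ℤ ^ n) * extension n -[1+ (n +ℕ k) ] ≡ W (n +ℕ k) k
    extension-at-negative zero    k    = sym (W-diag k)
    extension-at-negative (suc n) zero = begin
      -1ℤ * s * (extension (suc n) -[1+ n +ℕ 0 ] - c * extension n -[1+ n +ℕ 0 ])
        ≡⟨ cong₂ (λ a c′ → -1ℤ * s * (a - c′ * extension n -[1+ n +ℕ 0 ]))
                 (extension-roots (s≤s (ℕ.≤-reflexive (ℕ.+-identityʳ n)))) (coefficient≡γ n 0) ⟩
      -1ℤ * s * (0ℤ - γ (n +ℕ 0) 0 * extension n -[1+ n +ℕ 0 ])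
        ≡⟨ regroup s (γ (n +ℕ 0) 0) (extension n -[1+ n +ℕ 0 ]) ⟩
      γ (n +ℕ 0) 0 * (s * extension n -[1+ n +ℕ 0 ])
        ≡⟨ cong (γ (n +ℕ 0) 0 *_) (extension-at-negative n 0) ⟩
      γ (n +ℕ 0) 0 * W (n +ℕ 0) 0
        ≡⟨ sym (W-suc₀ (n +ℕ 0)) ⟩
      W (suc n +ℕ 0) 0 ∎
      where
      open ≡-Reasoning
      s = -1ℤ ^ n
      c = coefficient n -[1+ suc (n +ℕ 0) ]
      regroup : ∀ s c a → -1ℤ * s * (0ℤ - c * a) ≡ c * (s * a)
      regroup = solve-∀
    extension-at-negative (suc n) (suc k) = begin
      -1ℤ * s * (extension (suc n) -[1+ n +ℕ suc k ] - c * extension n -[1+ n +ℕ suc k ])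
        ≡⟨ regroup s c (extension (suc n) -[1+ n +ℕ suc k ]) (extension n -[1+ n +ℕ suc k ]) ⟩
      c * (s * extension n -[1+ n +ℕ suc k ]) + -1ℤ ^ suc n * extension (suc n) -[1+ n +ℕ suc k ]
        ≡⟨ cong₂ (λ c′ a → c′ * a + -1ℤ ^ suc n * extension (suc n) -[1+ n +ℕ suc k ])
                 (coefficient≡γ n (suc k)) (extension-at-negative n (suc k)) ⟩
      γ (n +ℕ suc k) (suc k) * W (n +ℕ suc k) (suc k) + -1ℤ ^ suc n * extension (suc n) -[1+ n +ℕ suc k ]
        ≡⟨ cong (_+_ (γ (n +ℕ suc k) (suc k) * W (n +ℕ suc k) (suc k))) lower-column ⟩
      γ (n +ℕ suc k) (suc k) * W (n +ℕ suc k) (suc k) + W (n +ℕ suc k) k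
        ≡⟨ sym (W-suc (n +ℕ suc k) k) ⟩
      W (suc n +ℕ suc k) (suc k) ∎
      where
      open ≡-Reasoning
      s = -1ℤ ^ n
      c = coefficient n -[1+ suc (n +ℕ suc k) ]
      regroup : ∀ s c a b → -1ℤ * s * (a - c * b) ≡ c * (s * b) + -1ℤ * s * a
      regroup = solve-∀
      lower-column : -1ℤ ^ suc n * extension (suc n) -[1+ n +ℕ suc k ] ≡ W (n +ℕ suc k) k
      lower-column = begin
        -1ℤ ^ suc n * extension (suc n) -[1+ n +ℕ suc k ]
          ≡⟨ cong (λ d → -1ℤ ^ suc n * extension (suc n) -[1+ d ]) (ℕ.+-suc n k) ⟩
        -1ℤ ^ suc n * extension (suc n) -[1+ suc n +ℕ k ]
          ≡⟨ extension-at-negative (suc n) k ⟩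
        W (suc n +ℕ k) k
          ≡⟨ cong (λ M → W M k) (sym (ℕ.+-suc n k)) ⟩
        W (n +ℕ suc k) k ∎

module FiniteDifferenceIdentity (st : ℕ → ℕ → ℕ) (n k p q : ℕ) (A : ℤ → ℤ) (n≤p : n ≤ p)
  (A-degree : Degree≤ℤ (n +ℕ n) A)
  (A-roots : ∀ {d} → d < n → A -[1+ d ] ≡ 0ℤ)
  (A-values : ∀ m → A (+ m) ≡ + st (n +ℕ m) m) where

  w N : ℕ
  w = n +ℕ k +ℕ q
  N = n +ℕ k +ℕ p +ℕ q +ℕ 1

  summand : ℕ → ℤ
  summand j = (-1ℤ ^ j) * + ((j +ℕ q) C q) * + ((n +ℕ k +ℕ q +ℕ j) C k)
            * + (N C (p ∸ℕ j)) * + st (n +ℕ j +ℕ q) (j +ℕ q)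

  G : ℤ → ℤ
  G x = binomialℤ (x + + q) q * binomialℤ (x + + w) k * A (x + + q)

  G-degree : Degree≤ℤ (q +ℕ k +ℕ (n +ℕ n)) G
  G-degree = Degree≤ℤ-* (λ x → binomialℤ (x + + q) q * binomialℤ (x + + w) k) (λ x → A (x + + q))
    (Degree≤ℤ-* (λ x → binomialℤ (x + + q) q) (λ x → binomialℤ (x + + w) k)
      (Degree≤ℤ-translate (λ x → binomialℤ x q) (+ q) (Degree≤ℤ-binomialℤ q))
      (Degree≤ℤ-translate (λ x → binomialℤ x k) (+ w) (Degree≤ℤ-binomialℤ k)))
    (Degree≤ℤ-translate A (+ q) A-degree)

  degree<N : q +ℕ k +ℕ (n +ℕ n) < N
  degree<N = subst (q +ℕ k +ℕ (n +ℕ n) <_) (rearrange n k p q)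
                   (s≤s (ℕ.+-monoʳ-≤ (q +ℕ k) (ℕ.+-monoʳ-≤ n n≤p)))
    where
    rearrange : ∀ n k p q → suc (q +ℕ k +ℕ (n +ℕ p)) ≡ n +ℕ k +ℕ p +ℕ q +ℕ 1
    rearrange = ℕ-solve-∀

  -- term i is the i-th summand of alternatingSum N (λ u → G (+ u - + suc w)).
  term : ℕ → ℤ
  term i = + (N C i) * ((-1ℤ ^ i) * G (+ i - + suc w)) * 1ℤ

  terms-vanish : sumBelow (suc N) term ≡ 0ℤ
  terms-vanish = alternatingSum-vanishes N (G-degree -[1+ w ]) degree<N

  term-head : term 0 ≡ (-1ℤ ^ (k +ℕ q)) * (+ ((n +ℕ k +ℕ q) C q) * A -[1+ n +ℕ k ])
  term-head = begin
    + 1 * (1ℤ * G -[1+ w ]) * 1ℤ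
      ≡⟨ unit (G -[1+ w ]) ⟩
    G -[1+ w ]
      ≡⟨ cong₂ (λ x y → binomialℤ x q * binomialℤ y k * A x) (shift-q (+ n) (+ k) (+ q)) (shift-w (+ w)) ⟩
    (-1ℤ ^ q) * Cq * ((-1ℤ ^ k) * + ((0 +ℕ k) C k)) * A -[1+ n +ℕ k ]
      ≡⟨ cong (λ c → (-1ℤ ^ q) * Cq * ((-1ℤ ^ k) * + c) * A -[1+ n +ℕ k ]) (nCn≡1 k) ⟩
    (-1ℤ ^ q) * Cq * ((-1ℤ ^ k) * 1ℤ) * A -[1+ n +ℕ k ]
      ≡⟨ regroup (-1ℤ ^ q) (-1ℤ ^ k) Cq (A -[1+ n +ℕ k ]) ⟩
    (-1ℤ ^ k) * (-1ℤ ^ q) * (Cq * A -[1+ n +ℕ k ])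
      ≡⟨ cong (_* (Cq * A -[1+ n +ℕ k ])) (sym (ℤ.^-distribˡ-+-* -1ℤ k q)) ⟩
    (-1ℤ ^ (k +ℕ q)) * (Cq * A -[1+ n +ℕ k ]) ∎
    where
    open ≡-Reasoning
    Cq = + ((n +ℕ k +ℕ q) C q)
    unit : ∀ g → + 1 * (1ℤ * g) * 1ℤ ≡ g
    unit = solve-∀
    shift-q : ∀ n k q → - (1ℤ + (n + k + q)) + q ≡ - (1ℤ + (n + k))
    shift-q = solve-∀
    shift-w : ∀ w → - (1ℤ + w) + w ≡ -1ℤ
    shift-w = solve-∀
    regroup : ∀ sq sk c a → sq * c * (sk * 1ℤ) * a ≡ sk * sq * (c * a)
    regroup = solve-∀

  term-root : ∀ i → G (+ i - + suc w) ≡ 0ℤ → term i ≡ 0ℤ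
  term-root i G≡0 rewrite G≡0 | ℤ.*-zeroʳ (-1ℤ ^ i) | ℤ.*-zeroʳ (+ (N C i)) = refl

  G-root-low : ∀ {t} → t < k → G (+ suc t - + suc w) ≡ 0ℤ
  G-root-low {t} t<k = begin
    binomialℤ (x + + q) q * binomialℤ (x + + w) k * A (x + + q)
      ≡⟨ cong (λ y → binomialℤ (x + + q) q * binomialℤ y k * A (x + + q)) (shift (+ t) (+ w)) ⟩
    binomialℤ (x + + q) q * + (t C k) * A (x + + q)
      ≡⟨ cong (λ c → binomialℤ (x + + q) q * + c * A (x + + q)) (k>n⇒nCk≡0 t<k) ⟩
    binomialℤ (x + + q) q * 0ℤ * A (x + + q)
      ≡⟨ cong (_* A (x + + q)) (ℤ.*-zeroʳ (binomialℤ (x + + q) q)) ⟩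
    0ℤ ∎
    where
    open ≡-Reasoning
    x = + suc t - + suc w
    shift : ∀ t w → (1ℤ + t) - (1ℤ + w) + w ≡ t
    shift = solve-∀

  G-root-middle : ∀ {s} → s < n → G (+ suc (k +ℕ s) - + suc w) ≡ 0ℤ
  G-root-middle {s} s<n = begin
    binomialℤ (x + + q) q * binomialℤ (x + + w) k * A (x + + q)
      ≡⟨ cong (λ y → binomialℤ (x + + q) q * binomialℤ (x + + w) k * A y)
              (trans (shift (+ n) (+ k) (+ q) (+ s)) ([+m]-[+n]≡-[1+n∸1+m] s<n)) ⟩
    binomialℤ (x + + q) q * binomialℤ (x + + w) k * A -[1+ n ∸ℕ suc s ]
      ≡⟨ cong (binomialℤ (x + + q) q * binomialℤ (x + + w) k *_) (A-roots (n∸1+m<n s<n)) ⟩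
    binomialℤ (x + + q) q * binomialℤ (x + + w) k * 0ℤ
      ≡⟨ ℤ.*-zeroʳ (binomialℤ (x + + q) q * binomialℤ (x + + w) k) ⟩
    0ℤ ∎
    where
    open ≡-Reasoning
    x = + suc (k +ℕ s) - + suc w
    shift : ∀ n k q s → (1ℤ + (k + s)) - (1ℤ + (n + k + q)) + q ≡ s - n
    shift = solve-∀
    n∸1+m<n : ∀ {m n} → m < n → n ∸ℕ suc m < n
    n∸1+m<n {m} {suc n} _ = s≤s (ℕ.m∸n≤m n m)

  G-root-high : ∀ {s} → s < q → G (+ suc (k +ℕ (n +ℕ s)) - + suc w) ≡ 0ℤ
  G-root-high {s} s<q = begin
    binomialℤ (x + + q) q * binomialℤ (x + + w) k * A (x + + q)
      ≡⟨ cong (λ y → binomialℤ y q * binomialℤ (x + + w) k * A (x + + q)) (shift (+ n) (+ k) (+ q) (+ s)) ⟩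
    + (s C q) * binomialℤ (x + + w) k * A (x + + q)
      ≡⟨ cong (λ c → + c * binomialℤ (x + + w) k * A (x + + q)) (k>n⇒nCk≡0 s<q) ⟩
    0ℤ * binomialℤ (x + + w) k * A (x + + q)
      ≡⟨⟩
    0ℤ ∎
    where
    open ≡-Reasoning
    x = + suc (k +ℕ (n +ℕ s)) - + suc w
    shift : ∀ n k q s → (1ℤ + (k + (n + s))) - (1ℤ + (n + k + q)) + q ≡ s
    shift = solve-∀

  middle-vanishes : sumBelow w (term ∘ suc) ≡ 0ℤ
  middle-vanishes = begin
    sumBelow w (term ∘ suc)
      ≡⟨ cong (λ m → sumBelow m (term ∘ suc)) (w≡k+[n+q] n k q) ⟩
    sumBelow (k +ℕ (n +ℕ q)) (term ∘ suc)
      ≡⟨ sumBelow-+ℕ k (n +ℕ q) (term ∘ suc) ⟩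
    sumBelow k (term ∘ suc) + sumBelow (n +ℕ q) (λ i → term (suc (k +ℕ i)))
      ≡⟨ cong (_+_ (sumBelow k (term ∘ suc))) (sumBelow-+ℕ n q (λ i → term (suc (k +ℕ i)))) ⟩
    sumBelow k (term ∘ suc)
      + (sumBelow n (λ s → term (suc (k +ℕ s))) + sumBelow q (λ s → term (suc (k +ℕ (n +ℕ s)))))
      ≡⟨ cong₂ _+_ (sumBelow-zero k (λ t t<k → term-root (suc t) (G-root-low t<k)))
                   (cong₂ _+_ (sumBelow-zero n (λ s s<n → term-root (suc (k +ℕ s)) (G-root-middle s<n)))
                              (sumBelow-zero q (λ s s<q → term-root (suc (k +ℕ (n +ℕ s))) (G-root-high s<q)))) ⟩
    0ℤ ∎
    where
    open ≡-Reasoning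
    w≡k+[n+q] : ∀ n k q → n +ℕ k +ℕ q ≡ k +ℕ (n +ℕ q)
    w≡k+[n+q] = ℕ-solve-∀

  N≡1+w+p : N ≡ suc w +ℕ p
  N≡1+w+p = rearrange n k p q
    where
    rearrange : ∀ n k p q → n +ℕ k +ℕ p +ℕ q +ℕ 1 ≡ suc (n +ℕ k +ℕ q) +ℕ p
    rearrange = ℕ-solve-∀

  term-tail : ∀ {j} → j ≤ p → term (suc w +ℕ j) ≡ -1ℤ ^ suc w * summand j
  term-tail {j} j≤p = begin
    + (N C (suc w +ℕ j)) * ((-1ℤ ^ (suc w +ℕ j)) * G (+ (suc w +ℕ j) - + suc w)) * 1ℤ
      ≡⟨ cong₂ (λ c s → + c * (s * G (+ (suc w +ℕ j) - + suc w)) * 1ℤ)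
               binomial-symmetry (ℤ.^-distribˡ-+-* -1ℤ (suc w) j) ⟩
    + (N C (p ∸ℕ j)) * ((-1ℤ ^ suc w) * (-1ℤ ^ j) * G (+ (suc w +ℕ j) - + suc w)) * 1ℤ
      ≡⟨ cong (λ x → + (N C (p ∸ℕ j)) * ((-1ℤ ^ suc w) * (-1ℤ ^ j) * G x) * 1ℤ) (cancel (+ suc w) (+ j)) ⟩
    + (N C (p ∸ℕ j)) * ((-1ℤ ^ suc w) * (-1ℤ ^ j) * (+ ((j +ℕ q) C q) * + ((j +ℕ w) C k) * A (+ (j +ℕ q)))) * 1ℤ
      ≡⟨ cong₂ (λ c a → + (N C (p ∸ℕ j)) * ((-1ℤ ^ suc w) * (-1ℤ ^ j) * (+ ((j +ℕ q) C q) * + (c C k) * a)) * 1ℤ)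
               (ℕ.+-comm j w) (trans (A-values (j +ℕ q)) (cong (λ m → + st m (j +ℕ q)) (sym (ℕ.+-assoc n j q)))) ⟩
    + (N C (p ∸ℕ j)) * ((-1ℤ ^ suc w) * (-1ℤ ^ j)
                        * (+ ((j +ℕ q) C q) * + ((w +ℕ j) C k) * + st (n +ℕ j +ℕ q) (j +ℕ q))) * 1ℤ
      ≡⟨ regroup (+ (N C (p ∸ℕ j))) (-1ℤ ^ suc w) (-1ℤ ^ j)
                 (+ ((j +ℕ q) C q)) (+ ((w +ℕ j) C k)) (+ st (n +ℕ j +ℕ q) (j +ℕ q)) ⟩
    -1ℤ ^ suc w * summand j ∎
    where
    open ≡-Reasoning
    cancel : ∀ o j → (o + j) - o ≡ j
    cancel = solve-∀
    regroup : ∀ c s₁ s₂ b₁ b₂ a → c * ((s₁ * s₂) * (b₁ * b₂ * a)) * 1ℤ ≡ s₁ * (s₂ * b₁ * b₂ * c * a)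
    regroup = solve-∀
    binomial-symmetry : N C (suc w +ℕ j) ≡ N C (p ∸ℕ j)
    binomial-symmetry = begin
      N C (suc w +ℕ j)
        ≡⟨ nCk≡nC[n∸k] (subst (suc w +ℕ j ≤_) (sym N≡1+w+p) (ℕ.+-monoʳ-≤ (suc w) j≤p)) ⟩
      N C (N ∸ℕ (suc w +ℕ j))
        ≡⟨ cong (λ m → N C (m ∸ℕ (suc w +ℕ j))) N≡1+w+p ⟩
      N C (suc w +ℕ p ∸ℕ (suc w +ℕ j))
        ≡⟨ cong (N C_) (ℕ.[m+n]∸[m+o]≡n∸o (suc w) p j) ⟩
      N C (p ∸ℕ j) ∎

  terms-split : term 0 + -1ℤ ^ suc w * sumTo p summand ≡ 0ℤ
  terms-split = begin
    term 0 + -1ℤ ^ suc w * sumTo p summand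
      ≡⟨ cong₂ _+_ (sym (ℤ.+-identityʳ (term 0))) (cong (-1ℤ ^ suc w *_) (sumTo≡sumBelow p summand)) ⟩
    term 0 + 0ℤ + -1ℤ ^ suc w * sumBelow (suc p) summand
      ≡⟨ cong₂ (λ m t → term 0 + m + t) (sym middle-vanishes) (sym (sumBelow-*ˡ (suc p) (-1ℤ ^ suc w) summand)) ⟩
    sumBelow (suc w) term + sumBelow (suc p) (λ j → -1ℤ ^ suc w * summand j)
      ≡⟨ cong (_+_ (sumBelow (suc w) term)) (sym (sumBelow-cong (suc p) (λ _ j<1+p → term-tail (ℕ.≤-pred j<1+p)))) ⟩
    sumBelow (suc w) term + sumBelow (suc p) (λ j → term (suc w +ℕ j))
      ≡⟨ sym (sumBelow-+ℕ (suc w) (suc p) term) ⟩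
    sumBelow (suc w +ℕ suc p) term
      ≡⟨ cong (λ m → sumBelow m term) (sym (trans (cong suc N≡1+w+p) (sym (ℕ.+-suc (suc w) p)))) ⟩
    sumBelow (suc N) term
      ≡⟨ terms-vanish ⟩
    0ℤ ∎
    where open ≡-Reasoning

  sumTo-summand≡ : sumTo p summand ≡ + ((n +ℕ k +ℕ q) C q) * ((-1ℤ ^ n) * A -[1+ n +ℕ k ])
  sumTo-summand≡ = begin
    sumTo p summand
      ≡⟨ x-sy≡0⇒y≡sx (-1ℤ ^ w) (term 0) (sumTo p summand) (-1^m*-1^m≡1 w) terms-split ⟩
    (-1ℤ ^ w) * term 0
      ≡⟨ cong ((-1ℤ ^ w) *_) term-head ⟩
    (-1ℤ ^ w) * ((-1ℤ ^ (k +ℕ q)) * (Cq * A′))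
      ≡⟨ sym (ℤ.*-assoc (-1ℤ ^ w) (-1ℤ ^ (k +ℕ q)) (Cq * A′)) ⟩
    (-1ℤ ^ w) * (-1ℤ ^ (k +ℕ q)) * (Cq * A′)
      ≡⟨ cong (λ e → (-1ℤ ^ e) * (-1ℤ ^ (k +ℕ q)) * (Cq * A′)) (ℕ.+-assoc n k q) ⟩
    (-1ℤ ^ (n +ℕ (k +ℕ q))) * (-1ℤ ^ (k +ℕ q)) * (Cq * A′)
      ≡⟨ cong (_* (Cq * A′)) (-1^[m+n]*-1^n≡-1^m n (k +ℕ q)) ⟩
    (-1ℤ ^ n) * (Cq * A′)
      ≡⟨ swap (-1ℤ ^ n) Cq A′ ⟩
    Cq * ((-1ℤ ^ n) * A′) ∎
    where
    open ≡-Reasoning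
    Cq = + ((n +ℕ k +ℕ q) C q)
    A′ = A -[1+ n +ℕ k ]
    swap : ∀ s c a → s * (c * a) ≡ c * (s * a)
    swap = solve-∀

rStirling1-diagonal : ∀ r m → rStirling1 r m m ≡ 1
rStirling1-diagonal r = diagonal (λ _ → refl) (λ _ _ → refl) refl
  where open LowerTriangular ℕ.+-*-semiring (rStirling1 r) (λ n _ → n +ℕ r)

rStirling2-diagonal : ∀ r m → rStirling2 r m m ≡ 1
rStirling2-diagonal r = diagonal (λ _ → refl) (λ _ _ → refl) refl
  where open LowerTriangular ℕ.+-*-semiring (rStirling2 r) (λ _ k → suc k +ℕ r)

rStirling1-rec : ∀ r n m → rStirling1 r (suc (n +ℕ suc m)) (suc m)
               ≡ (suc m +ℕ (n +ℕ r)) *ℕ rStirling1 r (n +ℕ suc m) (suc m) +ℕ rStirling1 r (n +ℕ suc m) m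
rStirling1-rec r n m =
  cong (λ c → c *ℕ rStirling1 r (n +ℕ suc m) (suc m) +ℕ rStirling1 r (n +ℕ suc m) m) (rearrange n m r)
  where
  rearrange : ∀ n m r → n +ℕ suc m +ℕ r ≡ suc m +ℕ (n +ℕ r)
  rearrange = ℕ-solve-∀

module rStirling1-extension (r : ℕ) =
  PolynomialExtension (rStirling1 r) (λ n → n +ℕ r) (rStirling1-diagonal r) (λ _ → refl) (rStirling1-rec r)

module rStirling2-extension (r : ℕ) =
  PolynomialExtension (rStirling2 r) (λ _ → r) (rStirling2-diagonal r) (λ _ → refl) (λ _ _ → refl)

[x-[M∸i]]-i≡x-M : ∀ x {M i} → i ≤ M → x - + (M ∸ℕ i) - + (i +ℕ 0) ≡ x - + M
[x-[M∸i]]-i≡x-M x {M} {i} i≤M =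
  trans (regroup x (+ (M ∸ℕ i)) (+ (i +ℕ 0)))
        (cong (λ m → x - + m) (trans (cong (_+ℕ (M ∸ℕ i)) (ℕ.+-identityʳ i)) (ℕ.m+[n∸m]≡n i≤M)))
  where
  regroup : ∀ x d i → x - d - i ≡ x - (i + d)
  regroup = solve-∀

module stirling2-powers (x : ℤ) =
  StirlingConvolution stirling2 (λ _ k → k +ℕ 0) (λ _ → refl) refl (λ _ → refl) (λ _ _ → refl)
    (x ^_) (const x) refl (λ m → ℤ.*-comm x (x ^ m))
    (λ _ k → x - + k) (λ _ k _ _ → cong (λ m → x - + m) (ℕ.+-identityʳ k))

module stirling1-falling (x : ℤ) =
  StirlingConvolution stirling1 (λ i _ → i +ℕ 0) (λ _ → refl) refl (λ _ → refl) (λ _ _ → refl)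
    (fallingℤ x) (λ m → x - + m) refl (λ _ → refl)
    (λ M _ → x - + M) (λ M _ i i≤M → [x-[M∸i]]-i≡x-M x i≤M)

rStirling1-at-negative : ∀ r n k → (-1ℤ ^ n) * rStirling1-extension.extension r n -[1+ n +ℕ k ]
  ≡ sumTo n (λ j → (-1ℤ ^ j) * + ((n +ℕ k) C (j +ℕ k)) * + stirling2 (j +ℕ k) k * ((+ r - 1ℤ) ^ (n ∸ℕ j)))
rStirling1-at-negative r n k =
  trans (extension-at-negative convolution (λ _ k → + r - 1ℤ - + k)
                               convolution-diagonal convolution-suc₀ convolution-suc coefficient≡γ n k)
        (sym (sumTo≡convolution n k))
  where
  open rStirling1-extension r
  open stirling2-powers (+ r - 1ℤ)
  shift : ∀ n k r → 1ℤ + - (1ℤ + (1ℤ + (n + k))) + (n + r) ≡ r - 1ℤ - k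
  shift = solve-∀
  coefficient≡γ : ∀ n k → coefficient n -[1+ suc (n +ℕ k) ] ≡ + r - 1ℤ - + k
  coefficient≡γ n k = shift (+ n) (+ k) (+ r)

rStirling2-at-negative : ∀ r n k → (-1ℤ ^ n) * rStirling2-extension.extension r n -[1+ n +ℕ k ]
  ≡ sumTo n (λ j → (-1ℤ ^ j) * + ((n +ℕ k) C (j +ℕ k)) * + stirling1 (j +ℕ k) k * fallingℤ (+ r - 1ℤ) (n ∸ℕ j))
rStirling2-at-negative r n k =
  trans (extension-at-negative convolution (λ M _ → + r - 1ℤ - + M)
                               convolution-diagonal convolution-suc₀ convolution-suc coefficient≡γ n k)
        (sym (sumTo≡convolution n k))
  where
  open rStirling2-extension r
  open stirling1-falling (+ r - 1ℤ)
  shift : ∀ m r → 1ℤ + - (1ℤ + (1ℤ + m)) + r ≡ r - 1ℤ - m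
  shift = solve-∀
  coefficient≡γ : ∀ n k → coefficient n -[1+ suc (n +ℕ k) ] ≡ + r - 1ℤ - + (n +ℕ k)
  coefficient≡γ n k = shift (+ (n +ℕ k)) (+ r)

corollary3 : (r n p q k : ℕ) → n ≤ p →
    (sumTo p (λ j → (-1ℤ ^ j) * + ((j +ℕ q) C q) * + ((n +ℕ k +ℕ q +ℕ j) C k)
        * + ((n +ℕ k +ℕ p +ℕ q +ℕ 1) C (p ∸ℕ j)) * + rStirling1 r (n +ℕ j +ℕ q) (j +ℕ q))
      ≡ + ((n +ℕ k +ℕ q) C q) * sumTo n (λ j → (-1ℤ ^ j) * + ((n +ℕ k) C (j +ℕ k))
        * + stirling2 (j +ℕ k) k * ((+ r - 1ℤ) ^ (n ∸ℕ j))))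
    × (sumTo p (λ j → (-1ℤ ^ j) * + ((j +ℕ q) C q) * + ((n +ℕ k +ℕ q +ℕ j) C k)
        * + ((n +ℕ k +ℕ p +ℕ q +ℕ 1) C (p ∸ℕ j)) * + rStirling2 r (n +ℕ j +ℕ q) (j +ℕ q))
      ≡ + ((n +ℕ k +ℕ q) C q) * sumTo n (λ j → (-1ℤ ^ j) * + ((n +ℕ k) C (j +ℕ k))
        * + stirling1 (j +ℕ k) k * fallingℤ (+ r - 1ℤ) (n ∸ℕ j)))
corollary3 r n p q k n≤p =
  trans I₁.sumTo-summand≡ (cong (+ ((n +ℕ k +ℕ q) C q) *_) (rStirling1-at-negative r n k)) ,
  trans I₂.sumTo-summand≡ (cong (+ ((n +ℕ k +ℕ q) C q) *_) (rStirling2-at-negative r n k))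
  where
  module E₁ = rStirling1-extension r
  module E₂ = rStirling2-extension r
  module I₁ = FiniteDifferenceIdentity (rStirling1 r) n k p q (E₁.extension n) n≤p
                (E₁.Degree≤ℤ-extension n) E₁.extension-roots (λ _ → refl)
  module I₂ = FiniteDifferenceIdentity (rStirling2 r) n k p q (E₂.extension n) n≤p
                (E₂.Degree≤ℤ-extension n) E₂.extension-roots (λ _ → refl)
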